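{- Let $X$ be a primitive distance-regular graph of diameter $d\geq 2$ on $n$ vertices with valency $k$, and let $\alpha,\beta>0$. Suppose that for some $1\leq j\leq d-1$ we have $b_j\geq\alpha k$ and $c_{j+1}\geq \beta k$. Then every two distinct vertices of $X$ are distinguished by at least $\frac{2\min(\alpha,\beta)}{d^2}(n-1)$ vertices.
   Context: A connected graph of diameter $d$ is distance-regular if for each $i$ there are constants $b_i,c_i$ such that for any vertices $v,w$ at distance $i$, $w$ has exactly $c_i$ neighbors at distance $i-1$ and $b_i$ at distance $i+1$ from $v$; $k=b_0$. It is primitive if every distance-$i$ graph ($1\le i\le d$) is connected. A vertex $x$ distinguishes vertices $u,v$ if $\mathrm{dist}(x,u)\neq\mathrm{dist}(x,v)$. -}

module Defs where

open import Data.Nat using (ℕ; zero; suc; _+_; _∸_; _≤_; _≡ᵇ_)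
open import Data.Bool using (Bool; true; false; if_then_else_; _∨_; _∧_; not)
open import Data.Bool.ListAction using (any)
open import Data.Fin using (_≟_)
open import Relation.Nullary.Decidable using (⌊_⌋)
open import Data.Fin using (Fin)
open import Data.List using (List; length; filterᵇ)
open import Data.List.Base using (allFin)
open import Data.Product using (Σ; ∃; _×_)
open import Relation.Binary.PropositionalEquality using (_≡_)

record Graph (n : ℕ) : Set where
  field
    adj     : Fin n → Fin n → Bool
    symm    : ∀ x y → adj x y ≡ adj y x
    irrefl  : ∀ x → adj x x ≡ false

card : {n : ℕ} → (Fin n → Bool) → ℕ
card {n} p = length (filterᵇ p (allFin n))

within : {n : ℕ} → (Fin n → Fin n → Bool) → ℕ → Fin n → Fin n → Bool
within {n} R zero    u v = ⌊ u ≟ v ⌋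
within {n} R (suc i) u v =
  within R i u v ∨ any (λ w → R u w ∧ within R i w v) (allFin n)

Connected : {n : ℕ} → (Fin n → Fin n → Bool) → Set
Connected R = ∀ u v → ∃ λ i → within R i u v ≡ true

-- least i < fuel (starting from i) with p i; returns the bound if none.
firstFrom : (ℕ → Bool) → ℕ → ℕ → ℕ
firstFrom p i zero       = i
firstFrom p i (suc fuel) = if p i then i else firstFrom p (suc i) fuel

-- Graph distance: least i with v reachable from u in ≤ i steps
-- (every finite distance in a graph on n vertices is < n).
dist : {n : ℕ} → Graph n → Fin n → Fin n → ℕ
dist {n} G u v = firstFrom (λ i → within (Graph.adj G) i u v) 0 n

nbrsAt : {n : ℕ} → Graph n → Fin n → Fin n → (ℕ → Bool) → ℕ
nbrsAt G u x p = card (λ w → Graph.adj G x w ∧ p (dist G u w))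

-- Distance-regular with intersection numbers b, c (k = b 0):
-- for all u, w at distance i, w has c i neighbours at distance i-1 and
-- b i neighbours at distance i+1 from u.
IsDistanceRegular : {n : ℕ} → Graph n → (b c : ℕ → ℕ) → Set
IsDistanceRegular G b c =
  Connected (Graph.adj G) ×
  (∀ u w → nbrsAt G u w (λ m → suc m ≡ᵇ dist G u w) ≡ c (dist G u w)
         × nbrsAt G u w (λ m → m ≡ᵇ suc (dist G u w)) ≡ b (dist G u w))

HasDiameter : {n : ℕ} → Graph n → ℕ → Set
HasDiameter {n} G d =
  (∀ u v → dist G u v ≤ d) × (Σ (Fin n) λ u → Σ (Fin n) λ v → dist G u v ≡ d)

distGraph : {n : ℕ} → Graph n → ℕ → Fin n → Fin n → Bool
distGraph G i x y = dist G x y ≡ᵇ i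

IsPrimitive : {n : ℕ} → Graph n → ℕ → Set
IsPrimitive G d = ∀ i → 1 ≤ i → i ≤ d → Connected (distGraph G i)

numDistinguishing : {n : ℕ} → Graph n → Fin n → Fin n → ℕ
numDistinguishing G u v = card (λ x → not (dist G x u ≡ᵇ dist G x v))

-- In a distance-regular graph the number |S_i(u) ∩ S_j(v)| of vertices at distance i from u and
-- j from v depends only on δ(u,v): double counting the edges between two spheres gives a recursion
-- in i whose leading coefficient is c_{i+1} ≠ 0. Hence D(u,v), the number of vertices distinguishing
-- u and v, also depends only on δ(u,v), and D satisfies the triangle inequality.
--
-- Since b is non-increasing and c non-decreasing, every vertex x sees at least M = min(b_j, c_{j+1})
-- neighbours v of a fixed vertex u with δ(x,v) ≠ δ(x,u); summing over x gives n·M ≤ k·D(u,y) for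
-- any edge uy. By primitivity the distance-i graph, i = δ(u,v), is connected. The set of distances
-- from a vertex x₀ realised by its walks of length ≤ t in that graph stops growing for good as soon
-- as it fails to grow once (the first fact lets us transfer walks between pairs at equal distance),
-- so it is complete at t = d: some neighbour y of x₀ is reached by a walk of length ≤ d. Each step
-- of the walk changes D by at most D(u,v), so n·M ≤ k·d·D(u,v); with αk ≤ b_j, βk ≤ c_{j+1} and
-- 2(n − 1) ≤ d·n this is the claim.

module Submission where

open import Defs
open import Data.Nat using (ℕ; suc; _≤_; _∸_; _*_)
open import Data.Fin using (Fin)
open import Data.Integer using (+_)
open import Data.Rational using (ℚ; Positive; _⊓_; _/_) renaming (_≤_ to _≤ℚ_; _*_ to _*ℚ_)
open import Relation.Binary.PropositionalEquality using (_≡_)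
open import Relation.Nullary using (¬_)

open import Data.Bool using (Bool; true; false; T; not; _∧_; _∨_; if_then_else_)
open import Data.Bool.ListAction using (any)
open import Data.Bool.Properties using (T-∧; T-∨; T-≡)
open import Data.Empty using (⊥; ⊥-elim)
open import Data.Fin using (zero; suc; punchIn; toℕ; fromℕ<) renaming (_≟_ to _≟ᶠ_)
open import Data.Fin.Properties using (punchInᵢ≢i; any?; toℕ-fromℕ<; toℕ-injective; toℕ<n)
import Data.Integer as ℤ
import Data.Integer.Properties as ℤ
open import Data.List.Base using (length; filterᵇ; tabulate; allFin)
open import Data.List.Membership.Propositional using (lose)
open import Data.List.Membership.Propositional.Properties using (∈-allFin)
open import Data.List.Relation.Unary.Any using (satisfied)
open import Data.List.Relation.Unary.Any.Properties using (any⁺; any⁻)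
open import Data.Nat using (zero; _+_; _<_; _≡ᵇ_; _≤′_; ≤′-refl; ≤′-step; z≤n; s≤s; _≟_; _≤?_; >-nonZero)
import Data.Nat as ℕ
open import Data.Nat.Coprimality using (1-coprimeTo) renaming (sym to coprime-sym)
open import Data.Nat.Induction using (<-rec)
open import Data.Nat.Properties
open import Algebra.Properties.CommutativeSemigroup *-commutativeSemigroup using (x∙yz≈y∙xz)
open import Algebra.Properties.Semiring.Sum +-*-semiring
  using (sum; sum-syntax; sum-cong-≗; ∑-distrib-+; ∑-comm; *-distribˡ-sum; *-distribʳ-sum; sum-remove; sum-replicate-zero)
open import Data.Nat.Solver using (module +-*-Solver)
open import Data.Product using (∃; _×_; _,_; proj₁; proj₂)
open import Data.Rational using (NonNegative; mkℚ; *≤*)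
import Data.Rational.Properties as ℚ
import Data.Rational.Solver as ℚ-Solver
open import Data.Sum using (_⊎_; inj₁; inj₂)
open import Function using (_∘_; id; Equivalence)
open import Relation.Binary.Definitions using (tri<; tri≈; tri>)
open import Relation.Binary.PropositionalEquality using (_≢_; refl; sym; trans; cong; cong₂; subst; subst₂; module ≡-Reasoning)
open import Relation.Nullary using (yes; no)
open import Relation.Nullary.Decidable using (⌊_⌋; T?; toWitness; fromWitness)

-- Indicators, finite sums and counting

variable
  n : ℕ

𝟙 : Bool → ℕ
𝟙 true  = 1
𝟙 false = 0

𝟙-mono : {a b : Bool} → (T a → T b) → 𝟙 a ≤ 𝟙 b
𝟙-mono {false}         _   = z≤n
𝟙-mono {true}  {true}  _   = ≤-refl
𝟙-mono {true}  {false} a⇒b = ⊥-elim (a⇒b _)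

𝟙-true : {a : Bool} → T a → 𝟙 a ≡ 1
𝟙-true {true} _ = refl

𝟙-false : {a : Bool} → ¬ T a → 𝟙 a ≡ 0
𝟙-false {false} _  = refl
𝟙-false {true}  ¬t = ⊥-elim (¬t _)

𝟙-∧ : (a b : Bool) → 𝟙 (a ∧ b) ≡ 𝟙 a * 𝟙 b
𝟙-∧ true  b = sym (+-identityʳ (𝟙 b))
𝟙-∧ false b = refl

𝟙-∨ : (a b : Bool) → 𝟙 (a ∨ b) ≤ 𝟙 a + 𝟙 b
𝟙-∨ true  b = s≤s z≤n
𝟙-∨ false b = ≤-refl

𝟙-split : (a b : Bool) → 𝟙 a ≡ 𝟙 (a ∧ b) + 𝟙 (a ∧ not b)
𝟙-split true  true  = refl
𝟙-split true  false = refl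
𝟙-split false b     = refl

𝟙-*-cong : ∀ {a : Bool} {x y} → (T a → x ≡ y) → 𝟙 a * x ≡ 𝟙 a * y
𝟙-*-cong {true}  x≡y = cong (1 *_) (x≡y _)
𝟙-*-cong {false} _   = refl

∧⁺ : {a b : Bool} → T a → T b → T (a ∧ b)
∧⁺ ta tb = Equivalence.from T-∧ (ta , tb)

∧⁻ : {a b : Bool} → T (a ∧ b) → T a × T b
∧⁻ = Equivalence.to T-∧

not⁺ : {a : Bool} → ¬ T a → T (not a)
not⁺ {false} _  = _
not⁺ {true}  ¬t = ¬t _

not⁻ : {a : Bool} → T (not a) → ¬ T a
not⁻ {false} _ ()

≡ᵇ⁺ : {m k : ℕ} → m ≡ k → T (m ≡ᵇ k)
≡ᵇ⁺ {m} {k} = ≡⇒≡ᵇ m k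

≡ᵇ⁻ : {m k : ℕ} → T (m ≡ᵇ k) → m ≡ k
≡ᵇ⁻ {m} {k} = ≡ᵇ⇒≡ m k

sum-mono-≤ : {f g : Fin n → ℕ} → (∀ x → f x ≤ g x) → sum f ≤ sum g
sum-mono-≤ {zero}  f≤g = z≤n
sum-mono-≤ {suc n} f≤g = +-mono-≤ (f≤g zero) (sum-mono-≤ (f≤g ∘ suc))

≤-sum : (f : Fin n → ℕ) (x : Fin n) → f x ≤ sum f
≤-sum {suc n} f x = ≤-trans (m≤m+n (f x) _) (≤-reflexive (sym (sum-remove f)))

sum-const : (m : ℕ) → ∑[ x < n ] m ≡ n * m
sum-const {zero}  m = refl
sum-const {suc n} m = cong (λ t → m + t) (sum-const {n} m)

sum-point : {f : Fin n → ℕ} (x : Fin n) → (∀ y → y ≢ x → f y ≡ 0) → sum f ≡ f x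
sum-point {suc n} {f} x f≗0 = begin
  sum f                     ≡⟨ sum-remove f ⟩
  f x + sum (f ∘ punchIn x) ≡⟨ cong (λ t → f x + t) (sum-cong-≗ (λ y → f≗0 _ (punchInᵢ≢i x y))) ⟩
  f x + sum {n} (λ _ → 0)   ≡⟨ cong (λ t → f x + t) (sum-replicate-zero n) ⟩
  f x + 0                   ≡⟨ +-identityʳ (f x) ⟩
  f x                       ∎
  where open ≡-Reasoning

sum-cancel-at : {f g : Fin n → ℕ} (x : Fin n) → (∀ y → y ≢ x → f y ≡ g y) →
                sum f ≡ sum g → f x ≡ g x
sum-cancel-at {suc n} {f} {g} x f≗g ∑f≡∑g = +-cancelʳ-≡ _ (f x) (g x) (begin
  f x + sum (f ∘ punchIn x) ≡⟨ sum-remove f ⟨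
  sum f                     ≡⟨ ∑f≡∑g ⟩
  sum g                     ≡⟨ sum-remove g ⟩
  g x + sum (g ∘ punchIn x) ≡⟨ cong (λ t → g x + t) (sum-cong-≗ (λ y → f≗g _ (punchInᵢ≢i x y))) ⟨
  g x + sum (f ∘ punchIn x) ∎)
  where open ≡-Reasoning

sum-at : ∀ {N} (f : ℕ → ℕ) {i} → i < N → ∑[ m < N ] (f (toℕ m) * 𝟙 (i ≡ᵇ toℕ m)) ≡ f i
sum-at {N} f {i} i<N = begin
  ∑[ m < N ] (f (toℕ m) * 𝟙 (i ≡ᵇ toℕ m)) ≡⟨ sum-point (fromℕ< i<N) (λ m m≢i → trans (cong (f (toℕ m) *_) (𝟙-false (m≢i ∘ at-i m))) (*-zeroʳ (f (toℕ m)))) ⟩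
  f (toℕ i′) * 𝟙 (i ≡ᵇ toℕ i′)           ≡⟨ cong (λ j → f j * 𝟙 (i ≡ᵇ j)) (toℕ-fromℕ< i<N) ⟩
  f i * 𝟙 (i ≡ᵇ i)                       ≡⟨ cong (f i *_) (𝟙-true (≡ᵇ⁺ {i} refl)) ⟩
  f i * 1                                ≡⟨ *-identityʳ (f i) ⟩
  f i                                    ∎
  where
  open ≡-Reasoning
  i′ = fromℕ< i<N
  at-i : ∀ m → T (i ≡ᵇ toℕ m) → m ≡ i′
  at-i m i≡m = toℕ-injective (trans (sym (≡ᵇ⁻ i≡m)) (sym (toℕ-fromℕ< i<N)))

sum-fibres : ∀ {N} (w : Fin n → ℕ) (F : Fin n → ℕ) (H : ℕ → ℕ) → (∀ x → F x < N) →
             ∑[ x < n ] (w x * H (F x)) ≡ ∑[ m < N ] (H (toℕ m) * ∑[ x < n ] (w x * 𝟙 (F x ≡ᵇ toℕ m)))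
sum-fibres {n} {N} w F H F<N = begin
  ∑[ x < n ] (w x * H (F x))                                   ≡⟨ sum-cong-≗ (λ x → cong (w x *_) (sum-at H (F<N x))) ⟨
  ∑[ x < n ] (w x * ∑[ m < N ] (H (toℕ m) * 𝟙 (F x ≡ᵇ toℕ m)))   ≡⟨ sum-cong-≗ (λ x → *-distribˡ-sum {N} (w x) (λ m → H (toℕ m) * 𝟙 (F x ≡ᵇ toℕ m))) ⟩
  ∑[ x < n ] ∑[ m < N ] (w x * (H (toℕ m) * 𝟙 (F x ≡ᵇ toℕ m))) ≡⟨ ∑-comm {n} {N} (λ x m → w x * (H (toℕ m) * 𝟙 (F x ≡ᵇ toℕ m))) ⟩
  ∑[ m < N ] ∑[ x < n ] (w x * (H (toℕ m) * 𝟙 (F x ≡ᵇ toℕ m))) ≡⟨ sum-cong-≗ {N} (λ m → sum-cong-≗ {n} (λ x → x∙yz≈y∙xz (w x) (H (toℕ m)) (𝟙 (F x ≡ᵇ toℕ m)))) ⟩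
  ∑[ m < N ] ∑[ x < n ] (H (toℕ m) * (w x * 𝟙 (F x ≡ᵇ toℕ m))) ≡⟨ sum-cong-≗ {N} (λ m → *-distribˡ-sum {n} (H (toℕ m)) (λ x → w x * 𝟙 (F x ≡ᵇ toℕ m))) ⟨
  ∑[ m < N ] (H (toℕ m) * ∑[ x < n ] (w x * 𝟙 (F x ≡ᵇ toℕ m)))   ∎
  where open ≡-Reasoning

_⊆ᵇ_ : (p q : Fin n → Bool) → Set
p ⊆ᵇ q = ∀ x → T (p x) → T (q x)

card≡sum : (p : Fin n → Bool) → card p ≡ ∑[ x < n ] 𝟙 (p x)
card≡sum {n} p = length-filter-tabulate id
  where
  length-filter-tabulate : ∀ {m} (f : Fin m → Fin n) →
    length (filterᵇ p (tabulate f)) ≡ ∑[ x < m ] 𝟙 (p (f x))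
  length-filter-tabulate {zero}  f = refl
  length-filter-tabulate {suc m} f with p (f zero)
  ... | true  = cong suc (length-filter-tabulate (f ∘ suc))
  ... | false = length-filter-tabulate (f ∘ suc)

card-mono : (p q : Fin n → Bool) → p ⊆ᵇ q → card p ≤ card q
card-mono p q p⊆q = begin
  card p             ≡⟨ card≡sum p ⟩
  sum (𝟙 ∘ p)        ≤⟨ sum-mono-≤ (λ x → 𝟙-mono (p⊆q x)) ⟩
  sum (𝟙 ∘ q)        ≡⟨ card≡sum q ⟨
  card q             ∎
  where open ≤-Reasoning

card-cong : (p q : Fin n → Bool) → p ⊆ᵇ q → q ⊆ᵇ p → card p ≡ card q
card-cong p q p⊆q q⊆p = ≤-antisym (card-mono p q p⊆q) (card-mono q p q⊆p)

card-empty : (p : Fin n → Bool) → (∀ x → ¬ T (p x)) → card p ≡ 0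
card-empty {n} p ¬p = n≤0⇒n≡0 (begin
  card p               ≤⟨ card-mono p (λ _ → false) (λ x px → ¬p x px) ⟩
  card {n} (λ _ → false) ≡⟨ card≡sum {n} (λ _ → false) ⟩
  ∑[ x < n ] 0         ≡⟨ sum-const {n} 0 ⟩
  n * 0                ≡⟨ *-zeroʳ n ⟩
  0                    ∎)
  where open ≤-Reasoning

card-full : card {n} (λ _ → true) ≡ n
card-full {n} = trans (card≡sum {n} (λ _ → true)) (trans (sum-const {n} 1) (*-identityʳ n))

card≤n : (p : Fin n → Bool) → card p ≤ n
card≤n {n} p = ≤-trans (card-mono p (λ _ → true) (λ _ _ → _)) (≤-reflexive (card-full {n}))

card-pos : (p : Fin n → Bool) (x : Fin n) → T (p x) → 0 < card p
card-pos p x px = begin-strict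
  0                  <⟨ s≤s z≤n ⟩
  1                  ≡⟨ 𝟙-true px ⟨
  𝟙 (p x)            ≤⟨ ≤-sum (𝟙 ∘ p) x ⟩
  sum (𝟙 ∘ p)        ≡⟨ card≡sum p ⟨
  card p             ∎
  where open ≤-Reasoning

card-witness : (p : Fin n → Bool) → 0 < card p → ∃ λ x → T (p x)
card-witness p 0<card with any? (T? ∘ p)
... | yes ∃p = ∃p
... | no  ∄p = ⊥-elim (<-irrefl (sym (card-empty p λ x px → ∄p (x , px))) 0<card)

card-split : (p q : Fin n → Bool) →
             card p ≡ card (λ x → p x ∧ q x) + card (λ x → p x ∧ not (q x))
card-split {n} p q = begin
  card p                                                ≡⟨ card≡sum p ⟩
  ∑[ x < n ] 𝟙 (p x)                                    ≡⟨ sum-cong-≗ (λ x → 𝟙-split (p x) (q x)) ⟩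
  ∑[ x < n ] (𝟙 (p x ∧ q x) + 𝟙 (p x ∧ not (q x)))     ≡⟨ ∑-distrib-+ (λ x → 𝟙 (p x ∧ q x)) _ ⟩
  ∑[ x < n ] 𝟙 (p x ∧ q x) + ∑[ x < n ] 𝟙 (p x ∧ not (q x)) ≡⟨ cong₂ _+_ (card≡sum (λ x → p x ∧ q x)) (card≡sum (λ x → p x ∧ not (q x))) ⟨
  card (λ x → p x ∧ q x) + card (λ x → p x ∧ not (q x)) ∎
  where open ≡-Reasoning

card-∨ : (p q : Fin n → Bool) → card (λ x → p x ∨ q x) ≤ card p + card q
card-∨ {n} p q = begin
  card (λ x → p x ∨ q x)              ≡⟨ card≡sum (λ x → p x ∨ q x) ⟩
  ∑[ x < n ] 𝟙 (p x ∨ q x)            ≤⟨ sum-mono-≤ (λ x → 𝟙-∨ (p x) (q x)) ⟩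
  ∑[ x < n ] (𝟙 (p x) + 𝟙 (q x))      ≡⟨ ∑-distrib-+ (𝟙 ∘ p) (𝟙 ∘ q) ⟩
  ∑[ x < n ] 𝟙 (p x) + ∑[ x < n ] 𝟙 (q x) ≡⟨ cong₂ _+_ (card≡sum p) (card≡sum q) ⟨
  card p + card q                     ∎
  where open ≤-Reasoning

card-strict-mono : (p q : Fin n → Bool) → p ⊆ᵇ q → (x : Fin n) → T (q x) → ¬ T (p x) →
                   card p < card q
card-strict-mono p q p⊆q x qx ¬px = begin-strict
  card p                                              ≤⟨ card-mono p (λ y → q y ∧ p y) (λ y py → ∧⁺ (p⊆q y py) py) ⟩
  card (λ y → q y ∧ p y)                              <⟨ m<m+n _ (card-pos (λ y → q y ∧ not (p y)) x (∧⁺ qx (not⁺ ¬px))) ⟩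
  card (λ y → q y ∧ p y) + card (λ y → q y ∧ not (p y)) ≡⟨ card-split q p ⟨
  card q                                              ∎
  where open ≤-Reasoning

card-mono-within : (p q r : Fin n → Bool) → (∀ x → T (p x) → T (q x) → T (r x)) →
                   card (λ x → p x ∧ q x) ≤ card (λ x → p x ∧ r x)
card-mono-within p q r q⇒r = card-mono (λ x → p x ∧ q x) (λ x → p x ∧ r x)
  (λ x h → let px , qx = ∧⁻ {p x} h in ∧⁺ px (q⇒r x px qx))

card-cong-within : (p q r : Fin n → Bool) →
                   (∀ x → T (p x) → T (q x) → T (r x)) → (∀ x → T (p x) → T (r x) → T (q x)) →
                   card (λ x → p x ∧ q x) ≡ card (λ x → p x ∧ r x)
card-cong-within p q r q⇒r r⇒q = ≤-antisym (card-mono-within p q r q⇒r) (card-mono-within p r q r⇒q)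

card-restrict : (p q : Fin n → Bool) → (∀ x → T (p x) → T (q x)) → card (λ x → p x ∧ q x) ≡ card p
card-restrict p q p⇒q = card-cong (λ x → p x ∧ q x) p (λ x → proj₁ ∘ ∧⁻) (λ x px → ∧⁺ px (p⇒q x px))

card-empty-within : (p q : Fin n → Bool) → (∀ x → T (p x) → ¬ T (q x)) → card (λ x → p x ∧ q x) ≡ 0
card-empty-within p q p⇒¬q = card-empty (λ x → p x ∧ q x) (λ x h → let px , qx = ∧⁻ h in p⇒¬q x px qx)

card-∨-disjoint : (p q r : Fin n → Bool) → (∀ x → T (p x) → T (q x) → ¬ T (r x)) →
                  card (λ x → p x ∧ (q x ∨ r x)) ≡ card (λ x → p x ∧ q x) + card (λ x → p x ∧ r x)
card-∨-disjoint {n} p q r disjoint = begin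
  card (λ x → p x ∧ (q x ∨ r x))                       ≡⟨ card≡sum (λ x → p x ∧ (q x ∨ r x)) ⟩
  ∑[ x < n ] 𝟙 (p x ∧ (q x ∨ r x))                     ≡⟨ sum-cong-≗ (λ x → 𝟙-∨-disjoint (p x) (q x) (r x) (disjoint x)) ⟩
  ∑[ x < n ] (𝟙 (p x ∧ q x) + 𝟙 (p x ∧ r x))           ≡⟨ ∑-distrib-+ (λ x → 𝟙 (p x ∧ q x)) _ ⟩
  ∑[ x < n ] 𝟙 (p x ∧ q x) + ∑[ x < n ] 𝟙 (p x ∧ r x)  ≡⟨ cong₂ _+_ (card≡sum (λ x → p x ∧ q x)) (card≡sum (λ x → p x ∧ r x)) ⟨
  card (λ x → p x ∧ q x) + card (λ x → p x ∧ r x)      ∎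
  where
  open ≡-Reasoning
  𝟙-∨-disjoint : ∀ a b c → (T a → T b → ¬ T c) → 𝟙 (a ∧ (b ∨ c)) ≡ 𝟙 (a ∧ b) + 𝟙 (a ∧ c)
  𝟙-∨-disjoint false b     c     _    = refl
  𝟙-∨-disjoint true  true  true  disj = ⊥-elim (disj _ _ _)
  𝟙-∨-disjoint true  true  false _    = refl
  𝟙-∨-disjoint true  false c     _    = refl

card-∧-comm : (p q : Fin n → Bool) → card (λ x → p x ∧ q x) ≡ card (λ x → q x ∧ p x)
card-∧-comm {n} p q = card-cong (λ x → p x ∧ q x) (λ x → q x ∧ p x) (swap p q) (swap q p)
  where
  swap : (p q : Fin n → Bool) → (λ x → p x ∧ q x) ⊆ᵇ (λ x → q x ∧ p x)
  swap p q x h = let px , qx = ∧⁻ {p x} h in ∧⁺ qx px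

-- Both sides count the pairs (x, y) with R x y, p x and q y.
∑-neighbours-swap : (R : Fin n → Fin n → Bool) → (∀ x y → R x y ≡ R y x) → (p q : Fin n → Bool) →
  ∑[ x < n ] (𝟙 (p x) * card (λ y → R x y ∧ q y)) ≡ ∑[ y < n ] (𝟙 (q y) * card (λ x → R y x ∧ p x))
∑-neighbours-swap {n} R R-sym p q = begin
  ∑[ x < n ] (𝟙 (p x) * card (λ y → R x y ∧ q y))         ≡⟨ sum-cong-≗ (λ x → cong (𝟙 (p x) *_) (card≡sum (λ y → R x y ∧ q y))) ⟩
  ∑[ x < n ] (𝟙 (p x) * ∑[ y < n ] 𝟙 (R x y ∧ q y))       ≡⟨ sum-cong-≗ (λ x → *-distribˡ-sum {n} (𝟙 (p x)) (λ y → 𝟙 (R x y ∧ q y))) ⟩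
  ∑[ x < n ] ∑[ y < n ] (𝟙 (p x) * 𝟙 (R x y ∧ q y))       ≡⟨ sum-cong-≗ (λ x → sum-cong-≗ (λ y → edge-term x y)) ⟩
  ∑[ x < n ] ∑[ y < n ] (𝟙 (q y) * 𝟙 (R y x ∧ p x))       ≡⟨ ∑-comm {n} {n} (λ x y → 𝟙 (q y) * 𝟙 (R y x ∧ p x)) ⟩
  ∑[ y < n ] ∑[ x < n ] (𝟙 (q y) * 𝟙 (R y x ∧ p x))       ≡⟨ sum-cong-≗ (λ y → *-distribˡ-sum {n} (𝟙 (q y)) (λ x → 𝟙 (R y x ∧ p x))) ⟨
  ∑[ y < n ] (𝟙 (q y) * ∑[ x < n ] 𝟙 (R y x ∧ p x))       ≡⟨ sum-cong-≗ (λ y → cong (𝟙 (q y) *_) (card≡sum (λ x → R y x ∧ p x))) ⟨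
  ∑[ y < n ] (𝟙 (q y) * card (λ x → R y x ∧ p x))         ∎
  where
  open ≡-Reasoning
  edge-term : ∀ x y → 𝟙 (p x) * 𝟙 (R x y ∧ q y) ≡ 𝟙 (q y) * 𝟙 (R y x ∧ p x)
  edge-term x y rewrite R-sym x y with R y x | p x | q y
  ... | false | px    | qy    = trans (*-zeroʳ (𝟙 px)) (sym (*-zeroʳ (𝟙 qy)))
  ... | true  | false | false = refl
  ... | true  | false | true  = refl
  ... | true  | true  | false = refl
  ... | true  | true  | true  = refl

module IncreasingChain {N : ℕ} (S : ℕ → Fin N → Bool)
  (increasing        : ∀ t → S t ⊆ᵇ S (suc t))
  (stable-propagates : ∀ t → S (suc t) ⊆ᵇ S t → S (suc (suc t)) ⊆ᵇ S (suc t))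
  (nonempty          : 0 < card (S 0))
  where

  Stable : ℕ → Set
  Stable t = S (suc t) ⊆ᵇ S t

  chain-mono : ∀ {t s} → t ≤′ s → S t ⊆ᵇ S s
  chain-mono ≤′-refl        x = id
  chain-mono (≤′-step t≤s) x = increasing _ x ∘ chain-mono t≤s x

  stable-above : ∀ {t s} → Stable t → t ≤′ s → S s ⊆ᵇ S t
  stable-above st ≤′-refl        x = id
  stable-above st (≤′-step t≤s) x = stable-above st t≤s x ∘ stable-step st t≤s x
    where
    stable-step : ∀ {t s} → Stable t → t ≤′ s → Stable s
    stable-step st ≤′-refl        = st
    stable-step st (≤′-step t≤s) = stable-propagates _ (stable-step st t≤s)

  stable-maximal : ∀ {t} → Stable t → ∀ s → S s ⊆ᵇ S t
  stable-maximal {t} st s with ≤-total s t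
  ... | inj₁ s≤t = chain-mono (≤⇒≤′ s≤t)
  ... | inj₂ t≤s = stable-above st (≤⇒≤′ t≤s)

  -- Until the chain stabilises every step adds an element, and there are only N of them.
  grows-or-stabilised : ∀ t → (∃ λ t′ → t′ < t × Stable t′) ⊎ t < card (S t)
  grows-or-stabilised zero = inj₂ nonempty
  grows-or-stabilised (suc t) with grows-or-stabilised t
  ... | inj₁ (t′ , t′<t , st) = inj₁ (t′ , m<n⇒m<1+n t′<t , st)
  ... | inj₂ t<card with card (S (suc t)) ≤? card (S t)
  ... | yes no-growth = inj₁ (t , ≤-refl , stable)
    where
    stable : Stable t
    stable x x∈ with T? (S t x)
    ... | yes x∈′ = x∈′
    ... | no  x∉  = ⊥-elim (<⇒≱ (card-strict-mono (S t) (S (suc t)) (increasing t) x x∈ x∉) no-growth)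
  ... | no  growth = inj₂ (≤-trans (s≤s t<card) (≰⇒> growth))

  saturated : ∀ t → S t ⊆ᵇ S (N ∸ 1)
  saturated t x x∈ with grows-or-stabilised N
  ... | inj₂ N<card = ⊥-elim (<⇒≱ N<card (card≤n (S N)))
  ... | inj₁ (t′ , t′<N , st) =
        chain-mono (≤⇒≤′ (<⇒≤pred t′<N))
                   x (stable-maximal st t x x∈)

-- Walks and graph distance

module Walks {n : ℕ} (R : Fin n → Fin n → Bool) where

  infixr 5 _∷_

  data Walk : ℕ → Fin n → Fin n → Set where
    []  : ∀ {i u} → Walk i u u
    _∷_ : ∀ {i u w v} → T (R u w) → Walk i w v → Walk (suc i) u v

  walk-step : ∀ {i u v} → Walk i u v → Walk (suc i) u v
  walk-step []      = []
  walk-step (e ∷ p) = e ∷ walk-step p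

  _∷ʳ_ : ∀ {i u w v} → Walk i u w → T (R w v) → Walk (suc i) u v
  []      ∷ʳ e = e ∷ []
  (e ∷ p) ∷ʳ f = e ∷ (p ∷ʳ f)

  unsnoc : ∀ {i u v} → Walk (suc i) u v → Walk i u v ⊎ ∃ λ w → Walk i u w × T (R w v)
  unsnoc []                = inj₁ []
  unsnoc {zero} (e ∷ [])   = inj₂ (_ , [] , e)
  unsnoc {suc i} (e ∷ p) with unsnoc p
  ... | inj₁ p′            = inj₁ (e ∷ p′)
  ... | inj₂ (w , q , f)   = inj₂ (w , e ∷ q , f)

  reverse : (∀ x y → R x y ≡ R y x) → ∀ {i u v} → Walk i u v → Walk i v u
  reverse R-sym []      = []
  reverse R-sym (e ∷ p) = reverse R-sym p ∷ʳ subst T (R-sym _ _) e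

  within-refl : ∀ i u → T (within R i u u)
  within-refl zero    u = fromWitness refl
  within-refl (suc i) u = Equivalence.from T-∨ (inj₁ (within-refl i u))

  within⇒walk : ∀ i {u v} → T (within R i u v) → Walk i u v
  within⇒walk zero {u} {v} u⇝v with toWitness {a? = u ≟ᶠ v} u⇝v
  ... | refl = []
  within⇒walk (suc i) {u} u⇝v with Equivalence.to T-∨ u⇝v
  ... | inj₁ u⇝v′ = walk-step (within⇒walk i u⇝v′)
  ... | inj₂ ∃w with satisfied (any⁻ _ (allFin n) ∃w)
  ... | w , h = let uw , w⇝v = ∧⁻ {R u w} h in uw ∷ within⇒walk i w⇝v

  walk⇒within : ∀ {i u v} → Walk i u v → T (within R i u v)
  walk⇒within {i} {u} []  = within-refl i u
  walk⇒within (_∷_ {w = w} e p) =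
    Equivalence.from T-∨ (inj₂ (any⁺ _ (lose (∈-allFin w) (∧⁺ e (walk⇒within p)))))

  -- The balls around u grow until the first step at which they do not, and are constant from then on.
  connected⇒walk : Connected R → ∀ u v → Walk (n ∸ 1) u v
  connected⇒walk connected u v with connected u v
  ... | i , u⇝v = within⇒walk _ (IncreasingChain.saturated (λ t → within R t u)
                    (λ t x → walk⇒within ∘ walk-step ∘ within⇒walk t)
                    stable-propagates (card-pos (within R 0 u) u (within-refl 0 u))
                    i v (Equivalence.from T-≡ u⇝v))
    where
    stable-propagates : ∀ t → (∀ x → T (within R (suc t) u x) → T (within R t u x)) →
                        ∀ x → T (within R (suc (suc t)) u x) → T (within R (suc t) u x)
    stable-propagates t stable x u⇝x with unsnoc (within⇒walk (suc (suc t)) u⇝x)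
    ... | inj₁ p           = walk⇒within p
    ... | inj₂ (w , p , e) = walk⇒within (within⇒walk t (stable w (walk⇒within p)) ∷ʳ e)

firstFrom-least : ∀ (p : ℕ → Bool) i fuel {m} → i ≤ m → T (p m) → firstFrom p i fuel ≤ m
firstFrom-least p i zero       i≤m pm = i≤m
firstFrom-least p i (suc fuel) i≤m pm with p i in pi≡
... | true  = i≤m
... | false = firstFrom-least p (suc i) fuel (≤∧≢⇒< i≤m i≢m) pm
  where
  i≢m : i ≢ _
  i≢m refl rewrite pi≡ = pm

firstFrom-sound : ∀ (p : ℕ → Bool) i fuel {m} → i ≤ m → m < i + fuel → T (p m) → T (p (firstFrom p i fuel))
firstFrom-sound p i zero       i≤m m<i+0 pm = ⊥-elim (<⇒≱ (subst (_ <_) (+-identityʳ i) m<i+0) i≤m)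
firstFrom-sound p i (suc fuel) {m} i≤m m<i+fuel pm with p i in pi≡
... | true  = subst T (sym pi≡) _
... | false = firstFrom-sound p (suc i) fuel (≤∧≢⇒< i≤m i≢m) (subst (m <_) (+-suc i fuel) m<i+fuel) pm
  where
  i≢m : i ≢ _
  i≢m refl rewrite pi≡ = pm

module Distance {n : ℕ} (G : Graph n) (connected : Connected (Graph.adj G)) where
  open Graph G
  open Walks adj public

  δ : Fin n → Fin n → ℕ
  δ = dist G

  dist-walk : ∀ u v → Walk (δ u v) u v
  dist-walk u v = within⇒walk _ (firstFrom-sound (λ i → within adj i u v) 0 n z≤n n∸1<n
                                   (walk⇒within (connected⇒walk connected u v)))
    where
    n∸1<n : n ∸ 1 < n
    n∸1<n = ∸-monoʳ-< (s≤s z≤n) (≤-<-trans z≤n (toℕ<n u))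

  dist-minimal : ∀ {i u v} → Walk i u v → δ u v ≤ i
  dist-minimal {i} {u} {v} p = firstFrom-least (λ i → within adj i u v) 0 n z≤n (walk⇒within p)

  dist-refl : ∀ u → δ u u ≡ 0
  dist-refl u = n≤0⇒n≡0 (dist-minimal {0} [])

  dist≡0⇒≡ : ∀ {u v} → δ u v ≡ 0 → u ≡ v
  dist≡0⇒≡ {u} {v} δ≡0 with subst (λ i → Walk i u v) δ≡0 (dist-walk u v)
  ... | [] = refl

  dist-sym : ∀ u v → δ u v ≡ δ v u
  dist-sym u v = ≤-antisym (dist-minimal (reverse symm (dist-walk v u)))
                           (dist-minimal (reverse symm (dist-walk u v)))

  adj⇒dist≡1 : ∀ {u v} → T (adj u v) → δ u v ≡ 1
  adj⇒dist≡1 {u} {v} uv = ≤-antisym (dist-minimal (uv ∷ [])) (n≢0⇒n>0 (u≢v ∘ dist≡0⇒≡))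
    where
    u≢v : u ≢ v
    u≢v refl = subst T (irrefl u) uv

  dist≡1⇒adj : ∀ {u v} → δ u v ≡ 1 → T (adj u v)
  dist≡1⇒adj {u} {v} δ≡1 with subst (λ i → Walk i u v) δ≡1 (dist-walk u v)
  ... | e ∷ [] = e
  ... | []     = ⊥-elim (0≢1+n (trans (sym (dist-refl u)) δ≡1))

  dist-adjacent : ∀ u {x y} → T (adj x y) → δ u y ≤ suc (δ u x)
  dist-adjacent u {x} {y} xy = dist-minimal (dist-walk u x ∷ʳ xy)

  dist-geodesic : ∀ u x {l} → δ u x ≡ suc l → ∃ λ y → T (adj x y) × δ u y ≡ l
  dist-geodesic u x {l} δ≡ with unsnoc (subst (λ i → Walk i u x) δ≡ (dist-walk u x))
  ... | inj₁ p           = ⊥-elim (1+n≰n (subst (_≤ l) δ≡ (dist-minimal p)))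
  ... | inj₂ (y , p , e) = y , subst T (symm y x) e ,
                           ≤-antisym (dist-minimal p) (≤-pred (subst (_≤ suc (δ u y)) δ≡ (dist-adjacent u e)))

  dist-adjacent-source : ∀ {x x′} → T (adj x x′) → ∀ w → δ x w ≤ suc (δ x′ w)
  dist-adjacent-source {x} {x′} xx′ w =
    subst₂ (λ p q → p ≤ suc q) (dist-sym w x) (dist-sym w x′) (dist-adjacent w (subst T (symm x x′) xx′))

  dist-adjacent-cases : ∀ u {x y} → T (adj x y) →
                        suc (δ u y) ≡ δ u x ⊎ δ u y ≡ δ u x ⊎ δ u y ≡ suc (δ u x)
  dist-adjacent-cases u {x} {y} xy with <-cmp (δ u y) (δ u x)
  ... | tri< y<x _ _ = inj₁ (≤-antisym y<x (dist-adjacent u (subst T (symm x y) xy)))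
  ... | tri≈ _ y≡x _ = inj₂ (inj₁ y≡x)
  ... | tri> _ _ x<y = inj₂ (inj₂ (≤-antisym (dist-adjacent u xy) x<y))

  dist-intermediate : ∀ u x {l m} → δ u x ≡ m → l ≤′ m → ∃ λ y → δ u y ≡ l
  dist-intermediate u x δ≡ ≤′-refl       = x , δ≡
  dist-intermediate u x δ≡ (≤′-step l≤m) with dist-geodesic u x δ≡
  ... | y , _ , δ≡′ = dist-intermediate u y δ≡′ l≤m

-- Distance-regular graphs

module DistanceRegular {n : ℕ} (G : Graph n) (b c : ℕ → ℕ) (d : ℕ)
  (drg : IsDistanceRegular G b c) (diameter : HasDiameter G d) where

  open Graph G
  open Distance G (proj₁ drg) public

  k : ℕ
  k = b 0

  neighboursAt : Fin n → Fin n → ℕ → ℕ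
  neighboursAt u x a = card (λ y → adj x y ∧ (δ u y ≡ᵇ a))

  neighbours-farther : ∀ u x → neighboursAt u x (suc (δ u x)) ≡ b (δ u x)
  neighbours-farther u x = proj₂ (proj₂ drg u x)

  neighbours-closer : ∀ u x → card (λ y → adj x y ∧ (suc (δ u y) ≡ᵇ δ u x)) ≡ c (δ u x)
  neighbours-closer u x = proj₁ (proj₂ drg u x)

  neighbours-closer-suc : ∀ u x {l} → δ u x ≡ suc l → neighboursAt u x l ≡ c (suc l)
  neighbours-closer-suc u x δ≡ =
    subst (λ m → card (λ y → adj x y ∧ (suc (δ u y) ≡ᵇ m)) ≡ c m) δ≡ (neighbours-closer u x)

  degree : ∀ x → card (adj x) ≡ k
  degree x = begin
    card (adj x)                   ≡⟨ card-restrict (adj x) (λ y → δ x y ≡ᵇ suc (δ x x)) (λ y xy → ≡ᵇ⁺ (at-distance-one xy)) ⟨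
    neighboursAt x x (suc (δ x x)) ≡⟨ neighbours-farther x x ⟩
    b (δ x x)                      ≡⟨ cong b (dist-refl x) ⟩
    k                              ∎
    where
    open ≡-Reasoning
    at-distance-one : ∀ {y} → T (adj x y) → δ x y ≡ suc (δ x x)
    at-distance-one xy = trans (adj⇒dist≡1 xy) (cong suc (sym (dist-refl x)))

  degree-partition : ∀ u x → k ≡ neighboursAt u x (δ u x) + (c (δ u x) + b (δ u x))
  degree-partition u x = begin
    k                                                               ≡⟨ degree x ⟨
    card (adj x)                                                    ≡⟨ card-split (adj x) same ⟩
    neighboursAt u x (δ u x) + card (λ y → adj x y ∧ not (same y))  ≡⟨ cong (λ t → neighboursAt u x (δ u x) + t) off-sphere ⟩
    neighboursAt u x (δ u x) + (c (δ u x) + b (δ u x))              ∎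
    where
    open ≡-Reasoning
    same closer farther : Fin n → Bool
    same    y = δ u y ≡ᵇ δ u x
    closer  y = suc (δ u y) ≡ᵇ δ u x
    farther y = δ u y ≡ᵇ suc (δ u x)

    off⇒cf : ∀ y → T (adj x y) → T (not (same y)) → T (closer y ∨ farther y)
    off⇒cf y xy off with dist-adjacent-cases u xy
    ... | inj₁ cl         = Equivalence.from T-∨ (inj₁ (≡ᵇ⁺ cl))
    ... | inj₂ (inj₁ sm)  = ⊥-elim (not⁻ off (≡ᵇ⁺ sm))
    ... | inj₂ (inj₂ far) = Equivalence.from T-∨ (inj₂ (≡ᵇ⁺ far))

    cf⇒off : ∀ y → T (adj x y) → T (closer y ∨ farther y) → T (not (same y))
    cf⇒off y xy cf with Equivalence.to (T-∨ {closer y}) cf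
    ... | inj₁ cl  = not⁺ λ sm → 1+n≢n (trans (≡ᵇ⁻ {suc (δ u y)} cl) (sym (≡ᵇ⁻ sm)))
    ... | inj₂ far = not⁺ λ sm → 1+n≢n (trans (sym (≡ᵇ⁻ {δ u y} far)) (≡ᵇ⁻ sm))

    off-sphere : card (λ y → adj x y ∧ not (same y)) ≡ c (δ u x) + b (δ u x)
    off-sphere = begin
      card (λ y → adj x y ∧ not (same y))                              ≡⟨ card-cong-within (adj x) (not ∘ same) (λ y → closer y ∨ farther y) off⇒cf cf⇒off ⟩
      card (λ y → adj x y ∧ (closer y ∨ farther y))                    ≡⟨ card-∨-disjoint (adj x) closer farther (λ y _ cl far → m≢1+n+m (δ u x) {1} (trans (sym (≡ᵇ⁻ cl)) (cong suc (≡ᵇ⁻ far)))) ⟩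
      card (λ y → adj x y ∧ closer y) + card (λ y → adj x y ∧ farther y) ≡⟨ cong₂ _+_ (neighbours-closer u x) (neighbours-farther u x) ⟩
      c (δ u x) + b (δ u x)                                            ∎

  -- p₁ m a is the intersection number p^m_{1a}, the number of neighbours at distance a from u
  -- of a vertex at distance m from u; k ∸ (c m + b m) is the usual a_m.
  p₁ : ℕ → ℕ → ℕ
  p₁ m a = if ⌊ suc a ≟ m ⌋ then c m
           else if ⌊ a ≟ suc m ⌋ then b m
           else if ⌊ a ≟ m ⌋ then k ∸ (c m + b m)
           else 0

  neighboursAt≡p₁ : ∀ u x a → neighboursAt u x a ≡ p₁ (δ u x) a
  neighboursAt≡p₁ u x a with suc a ≟ δ u x
  ... | yes closer = trans (neighbours-closer-suc u x (sym closer)) (cong c closer)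
  ... | no ¬closer with a ≟ suc (δ u x)
  ... | yes refl = neighbours-farther u x
  ... | no ¬farther with a ≟ δ u x
  ... | yes refl = sym (trans (cong (_∸ (c (δ u x) + b (δ u x))) (degree-partition u x))
                              (m+n∸n≡m _ (c (δ u x) + b (δ u x))))
  ... | no ¬same = card-empty-within (adj x) (λ y → δ u y ≡ᵇ a) λ y xy at-a →
                     case-absurd (subst (λ z → _ ⊎ z ≡ δ u x ⊎ z ≡ suc (δ u x)) (≡ᵇ⁻ at-a) (dist-adjacent-cases u xy))
    where
    case-absurd : suc a ≡ δ u x ⊎ a ≡ δ u x ⊎ a ≡ suc (δ u x) → ⊥
    case-absurd (inj₁ cl)         = ¬closer cl
    case-absurd (inj₂ (inj₁ sm))  = ¬same sm
    case-absurd (inj₂ (inj₂ far)) = ¬farther far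

  p₁-closer : ∀ i → p₁ (suc i) i ≡ c (suc i)
  p₁-closer i with suc i ≟ suc i
  ... | yes _  = refl
  ... | no  ≢i = ⊥-elim (≢i refl)

  p₁-far : ∀ {m} i → suc (suc i) ≤ m → p₁ m i ≡ 0
  p₁-far {m} i 2+i≤m with suc i ≟ m
  ... | yes refl = ⊥-elim (1+n≰n 2+i≤m)
  ... | no _ with i ≟ suc m
  ... | yes refl = ⊥-elim (1+n≰n (≤-trans (m≤n+m (suc m) 2) 2+i≤m))
  ... | no _ with i ≟ m
  ... | yes refl = ⊥-elim (1+n≰n (≤-trans (n≤1+n (suc i)) 2+i≤m))
  ... | no _ = refl

  dist≤d : ∀ u v → δ u v ≤ d
  dist≤d = proj₁ diameter

  dist<1+d : ∀ u v → δ u v < suc d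
  dist<1+d u v = s≤s (dist≤d u v)

  pair-at-distance : ∀ {l} → l ≤ d → ∃ λ u → ∃ λ y → δ u y ≡ l
  pair-at-distance l≤d with proj₂ diameter
  ... | u , v , δ≡d = u , dist-intermediate u v δ≡d (≤⇒≤′ l≤d)

  c-pos : ∀ {i} → suc i ≤ d → 0 < c (suc i)
  c-pos {i} 1+i≤d with pair-at-distance 1+i≤d
  ... | u , x , δ≡ with dist-geodesic u x δ≡
  ... | y , xy , δy = subst (0 <_) (neighbours-closer-suc u x δ≡)
                        (card-pos (λ y → adj x y ∧ (δ u y ≡ᵇ i)) y (∧⁺ xy (≡ᵇ⁺ δy)))

  k-pos : 1 ≤ d → 0 < k
  k-pos 1≤d with pair-at-distance 1≤d
  ... | u , y , δ≡1 = subst (0 <_) (degree u) (card-pos (adj u) y (dist≡1⇒adj δ≡1))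

  -- |S_i(u) ∩ S_j(v)|, which turns out to be the intersection number p^{δ u v}_{ij}.
  sphereMeet : Fin n → Fin n → ℕ → ℕ → ℕ
  sphereMeet u v i j = card (λ x → (δ u x ≡ᵇ i) ∧ (δ v x ≡ᵇ j))

  sphereMeet≡sum : ∀ u v i j → sphereMeet u v i j ≡ ∑[ x < n ] (𝟙 (δ u x ≡ᵇ i) * 𝟙 (δ v x ≡ᵇ j))
  sphereMeet≡sum u v i j = trans (card≡sum (λ x → (δ u x ≡ᵇ i) ∧ (δ v x ≡ᵇ j)))
                                 (sum-cong-≗ (λ x → 𝟙-∧ (δ u x ≡ᵇ i) (δ v x ≡ᵇ j)))

  sphereMeet-sym : ∀ u v i j → sphereMeet u v i j ≡ sphereMeet v u j i
  sphereMeet-sym u v i j = card-∧-comm (λ x → δ u x ≡ᵇ i) (λ x → δ v x ≡ᵇ j)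

  sphereMeet-zero : ∀ u v j → sphereMeet u v 0 j ≡ 𝟙 (δ v u ≡ᵇ j)
  sphereMeet-zero u v j = begin
    sphereMeet u v 0 j                           ≡⟨ card≡sum (λ x → (δ u x ≡ᵇ 0) ∧ (δ v x ≡ᵇ j)) ⟩
    ∑[ x < n ] 𝟙 ((δ u x ≡ᵇ 0) ∧ (δ v x ≡ᵇ j))  ≡⟨ sum-point u (λ x x≢u → 𝟙-false (x≢u ∘ only-u x)) ⟩
    𝟙 ((δ u u ≡ᵇ 0) ∧ (δ v u ≡ᵇ j))             ≡⟨ cong (λ z → 𝟙 ((z ≡ᵇ 0) ∧ (δ v u ≡ᵇ j))) (dist-refl u) ⟩
    𝟙 (δ v u ≡ᵇ j)                               ∎
    where
    open ≡-Reasoning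
    only-u : ∀ x → T ((δ u x ≡ᵇ 0) ∧ (δ v x ≡ᵇ j)) → x ≡ u
    only-u x h = sym (dist≡0⇒≡ (≡ᵇ⁻ (proj₁ (∧⁻ {δ u x ≡ᵇ 0} h))))

  sphereMeet-beyond : ∀ u v {i} j → d < i → sphereMeet u v i j ≡ 0
  sphereMeet-beyond u v {i} j d<i = card-empty (λ x → (δ u x ≡ᵇ i) ∧ (δ v x ≡ᵇ j)) λ x h →
    <⇒≱ d<i (subst (_≤ d) (≡ᵇ⁻ (proj₁ (∧⁻ {δ u x ≡ᵇ i} h))) (dist≤d u x))

  ∑-neighboursAt : ∀ u v i j →
    ∑[ x < n ] (𝟙 (δ u x ≡ᵇ i) * neighboursAt v x j) ≡ ∑[ m < suc d ] (p₁ (toℕ m) j * sphereMeet u v i (toℕ m))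
  ∑-neighboursAt u v i j = begin
    ∑[ x < n ] (𝟙 (δ u x ≡ᵇ i) * neighboursAt v x j)
      ≡⟨ sum-cong-≗ (λ x → cong (𝟙 (δ u x ≡ᵇ i) *_) (neighboursAt≡p₁ v x j)) ⟩
    ∑[ x < n ] (𝟙 (δ u x ≡ᵇ i) * p₁ (δ v x) j)
      ≡⟨ sum-fibres (λ x → 𝟙 (δ u x ≡ᵇ i)) (δ v) (λ m → p₁ m j) (dist<1+d v) ⟩
    ∑[ m < suc d ] (p₁ (toℕ m) j * ∑[ x < n ] (𝟙 (δ u x ≡ᵇ i) * 𝟙 (δ v x ≡ᵇ toℕ m)))
      ≡⟨ sum-cong-≗ {suc d} (λ m → cong (p₁ (toℕ m) j *_) (sphereMeet≡sum u v i (toℕ m))) ⟨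
    ∑[ m < suc d ] (p₁ (toℕ m) j * sphereMeet u v i (toℕ m)) ∎
    where open ≡-Reasoning

  -- Both sides count the edges xy with δ u x = i and δ v y = j.
  sphereMeet-double-count : ∀ u v i j →
    ∑[ m < suc d ] (p₁ (toℕ m) j * sphereMeet u v i (toℕ m)) ≡ ∑[ m < suc d ] (p₁ (toℕ m) i * sphereMeet u v (toℕ m) j)
  sphereMeet-double-count u v i j = begin
    ∑[ m < suc d ] (p₁ (toℕ m) j * sphereMeet u v i (toℕ m)) ≡⟨ ∑-neighboursAt u v i j ⟨
    ∑[ x < n ] (𝟙 (δ u x ≡ᵇ i) * neighboursAt v x j)       ≡⟨ ∑-neighbours-swap adj symm (λ x → δ u x ≡ᵇ i) (λ y → δ v y ≡ᵇ j) ⟩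
    ∑[ y < n ] (𝟙 (δ v y ≡ᵇ j) * neighboursAt u y i)       ≡⟨ ∑-neighboursAt v u j i ⟩
    ∑[ m < suc d ] (p₁ (toℕ m) i * sphereMeet v u j (toℕ m)) ≡⟨ sum-cong-≗ {suc d} (λ m → cong (p₁ (toℕ m) i *_) (sphereMeet-sym v u j (toℕ m))) ⟩
    ∑[ m < suc d ] (p₁ (toℕ m) i * sphereMeet u v (toℕ m) j) ∎
    where open ≡-Reasoning

  -- The double count for (i, j) expresses c (suc i) · |S_{i+1}(u) ∩ S_j(v)| through the spheres
  -- S_m(u) with m ≤ i, because p₁ m i vanishes for m ≥ i + 2 and c (suc i) ≠ 0.
  sphereMeet-step : ∀ {u v u′ v′ i} → suc i ≤ d →
                    (∀ {m} → m ≤ i → ∀ j → sphereMeet u v m j ≡ sphereMeet u′ v′ m j) →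
                    ∀ j → sphereMeet u v (suc i) j ≡ sphereMeet u′ v′ (suc i) j
  sphereMeet-step {u} {v} {u′} {v′} {i} 1+i≤d below j =
    *-cancelˡ-≡ _ _ (c (suc i)) {{>-nonZero (c-pos 1+i≤d)}} (begin
      c (suc i) * sphereMeet u v (suc i) j     ≡⟨ at-top u v ⟨
      term u v top                             ≡⟨ sum-cancel-at top terms-agree sums-agree ⟩
      term u′ v′ top                           ≡⟨ at-top u′ v′ ⟩
      c (suc i) * sphereMeet u′ v′ (suc i) j   ∎)
    where
    open ≡-Reasoning
    term : Fin n → Fin n → Fin (suc d) → ℕ
    term x y m = p₁ (toℕ m) i * sphereMeet x y (toℕ m) j

    top : Fin (suc d)
    top = fromℕ< (s≤s 1+i≤d)

    at-top : ∀ x y → term x y top ≡ c (suc i) * sphereMeet x y (suc i) j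
    at-top x y = trans (cong (λ t → p₁ t i * sphereMeet x y t j) (toℕ-fromℕ< (s≤s 1+i≤d)))
                       (cong (_* sphereMeet x y (suc i) j) (p₁-closer i))

    sums-agree : sum (term u v) ≡ sum (term u′ v′)
    sums-agree = begin
      sum (term u v)                                               ≡⟨ sphereMeet-double-count u v i j ⟨
      ∑[ m < suc d ] (p₁ (toℕ m) j * sphereMeet u v i (toℕ m))    ≡⟨ sum-cong-≗ {suc d} (λ m → cong (p₁ (toℕ m) j *_) (below ≤-refl (toℕ m))) ⟩
      ∑[ m < suc d ] (p₁ (toℕ m) j * sphereMeet u′ v′ i (toℕ m))  ≡⟨ sphereMeet-double-count u′ v′ i j ⟩
      sum (term u′ v′)                                             ∎

    terms-agree : ∀ m → m ≢ top → term u v m ≡ term u′ v′ m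
    terms-agree m m≢top with toℕ m ≤? i
    ... | yes m≤i = cong (p₁ (toℕ m) i *_) (below m≤i j)
    ... | no  m≰i = trans (cong (_* sphereMeet u v (toℕ m) j) (p₁-far i 2+i≤m))
                          (sym (cong (_* sphereMeet u′ v′ (toℕ m) j) (p₁-far i 2+i≤m)))
      where
      2+i≤m : suc (suc i) ≤ toℕ m
      2+i≤m = ≤∧≢⇒< (≰⇒> m≰i) λ 1+i≡m → m≢top (toℕ-injective (trans (sym 1+i≡m) (sym (toℕ-fromℕ< (s≤s 1+i≤d)))))

  sphereMeet-determined : ∀ {u v u′ v′} → δ u v ≡ δ u′ v′ →
                          ∀ i j → sphereMeet u v i j ≡ sphereMeet u′ v′ i j
  sphereMeet-determined {u} {v} {u′} {v′} same-dist = <-rec Agree agree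
    where
    Agree : ℕ → Set
    Agree i = ∀ j → sphereMeet u v i j ≡ sphereMeet u′ v′ i j

    agree : ∀ i → (∀ {m} → m < i → Agree m) → Agree i
    agree zero _ j = begin
      sphereMeet u v 0 j    ≡⟨ sphereMeet-zero u v j ⟩
      𝟙 (δ v u ≡ᵇ j)        ≡⟨ cong (λ z → 𝟙 (z ≡ᵇ j)) (trans (dist-sym v u) (trans same-dist (dist-sym u′ v′))) ⟩
      𝟙 (δ v′ u′ ≡ᵇ j)      ≡⟨ sphereMeet-zero u′ v′ j ⟨
      sphereMeet u′ v′ 0 j  ∎
      where open ≡-Reasoning
    agree (suc i) below j with suc i ≤? d
    ... | yes 1+i≤d = sphereMeet-step 1+i≤d (λ m≤i → below (s≤s m≤i)) j
    ... | no  1+i≰d = trans (sphereMeet-beyond u v j (≰⇒> 1+i≰d)) (sym (sphereMeet-beyond u′ v′ j (≰⇒> 1+i≰d)))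

  D : Fin n → Fin n → ℕ
  D = numDistinguishing G

  agreeing : Fin n → Fin n → ℕ
  agreeing u v = card (λ x → δ x u ≡ᵇ δ x v)

  agreeing+D : ∀ u v → agreeing u v + D u v ≡ n
  agreeing+D u v = trans (sym (card-split (λ _ → true) (λ x → δ x u ≡ᵇ δ x v))) card-full

  agreeing≡∑sphereMeet : ∀ u v → agreeing u v ≡ ∑[ m < suc d ] sphereMeet u v (toℕ m) (toℕ m)
  agreeing≡∑sphereMeet u v = begin
    agreeing u v                                                    ≡⟨ card≡sum (λ x → δ x u ≡ᵇ δ x v) ⟩
    ∑[ x < n ] 𝟙 (δ x u ≡ᵇ δ x v)                                   ≡⟨ sum-cong-≗ (λ x → cong₂ (λ p q → 𝟙 (p ≡ᵇ q)) (dist-sym x u) (dist-sym x v)) ⟩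
    ∑[ x < n ] 𝟙 (δ u x ≡ᵇ δ v x)                                   ≡⟨ sum-cong-≗ (λ x → sum-at (λ m → 𝟙 (δ u x ≡ᵇ m)) (dist<1+d v x)) ⟨
    ∑[ x < n ] ∑[ m < suc d ] (𝟙 (δ u x ≡ᵇ toℕ m) * 𝟙 (δ v x ≡ᵇ toℕ m)) ≡⟨ ∑-comm {n} {suc d} (λ x m → 𝟙 (δ u x ≡ᵇ toℕ m) * 𝟙 (δ v x ≡ᵇ toℕ m)) ⟩
    ∑[ m < suc d ] ∑[ x < n ] (𝟙 (δ u x ≡ᵇ toℕ m) * 𝟙 (δ v x ≡ᵇ toℕ m)) ≡⟨ sum-cong-≗ {suc d} (λ m → sphereMeet≡sum u v (toℕ m) (toℕ m)) ⟨
    ∑[ m < suc d ] sphereMeet u v (toℕ m) (toℕ m)                   ∎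
    where open ≡-Reasoning

  D-determined : ∀ {u v u′ v′} → δ u v ≡ δ u′ v′ → D u v ≡ D u′ v′
  D-determined {u} {v} {u′} {v′} same-dist = +-cancelˡ-≡ (agreeing u v) _ _ (begin
    agreeing u v + D u v     ≡⟨ agreeing+D u v ⟩
    n                        ≡⟨ agreeing+D u′ v′ ⟨
    agreeing u′ v′ + D u′ v′ ≡⟨ cong (_+ D u′ v′) agreeing-equal ⟨
    agreeing u v + D u′ v′   ∎)
    where
    open ≡-Reasoning
    agreeing-equal : agreeing u v ≡ agreeing u′ v′
    agreeing-equal = trans (agreeing≡∑sphereMeet u v)
      (trans (sum-cong-≗ {suc d} (λ m → sphereMeet-determined same-dist (toℕ m) (toℕ m)))
             (sym (agreeing≡∑sphereMeet u′ v′)))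

  D-self : ∀ u → D u u ≡ 0
  D-self u = card-empty (λ x → not (δ x u ≡ᵇ δ x u)) (λ x h → not⁻ h (≡ᵇ⁺ {δ x u} refl))

  D-triangle : ∀ u w v → D u v ≤ D u w + D w v
  D-triangle u w v = ≤-trans (card-mono _ (λ x → not (δ x u ≡ᵇ δ x w) ∨ not (δ x w ≡ᵇ δ x v)) split)
                             (card-∨ (λ x → not (δ x u ≡ᵇ δ x w)) (λ x → not (δ x w ≡ᵇ δ x v)))
    where
    split : ∀ x → T (not (δ x u ≡ᵇ δ x v)) → T (not (δ x u ≡ᵇ δ x w) ∨ not (δ x w ≡ᵇ δ x v))
    split x u≠v with δ x u ≟ δ x w
    ... | no  u≠w = Equivalence.from T-∨ (inj₁ (not⁺ (u≠w ∘ ≡ᵇ⁻)))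
    ... | yes u≡w = Equivalence.from T-∨ (inj₂ (not⁺ λ w≡v → not⁻ u≠v (≡ᵇ⁺ (trans u≡w (≡ᵇ⁻ w≡v)))))

  -- Seen from x, the neighbours of u at distance δ x u + 1 (or δ x u - 1) all differ from u.
  distinguishing-neighbours : ∀ {M} → (∀ l → l ≤ d → M ≤ b l ⊎ M ≤ c l) →
                              ∀ u x → M ≤ card (λ v → adj u v ∧ not (δ x u ≡ᵇ δ x v))
  distinguishing-neighbours {M} M≤b⊎c u x with M≤b⊎c (δ x u) (dist≤d x u)
  ... | inj₁ M≤b = begin
    M                                                 ≤⟨ M≤b ⟩
    b (δ x u)                                         ≡⟨ neighbours-farther x u ⟨
    card (λ v → adj u v ∧ (δ x v ≡ᵇ suc (δ x u)))     ≤⟨ card-mono-within (adj u) (λ v → δ x v ≡ᵇ suc (δ x u)) (λ v → not (δ x u ≡ᵇ δ x v))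
                                                           (λ v _ far → not⁺ λ same → 1+n≢n (trans (sym (≡ᵇ⁻ {δ x v} far)) (sym (≡ᵇ⁻ {δ x u} same)))) ⟩
    card (λ v → adj u v ∧ not (δ x u ≡ᵇ δ x v))       ∎
    where open ≤-Reasoning
  ... | inj₂ M≤c = begin
    M                                                 ≤⟨ M≤c ⟩
    c (δ x u)                                         ≡⟨ neighbours-closer x u ⟨
    card (λ v → adj u v ∧ (suc (δ x v) ≡ᵇ δ x u))     ≤⟨ card-mono-within (adj u) (λ v → suc (δ x v) ≡ᵇ δ x u) (λ v → not (δ x u ≡ᵇ δ x v))
                                                           (λ v _ cl → not⁺ λ same → 1+n≢n (trans (≡ᵇ⁻ {suc (δ x v)} cl) (≡ᵇ⁻ {δ x u} same))) ⟩
    card (λ v → adj u v ∧ not (δ x u ≡ᵇ δ x v))       ∎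
    where open ≤-Reasoning

  ∑-distinguishing-neighbours : ∀ u →
    ∑[ x < n ] card (λ v → adj u v ∧ not (δ x u ≡ᵇ δ x v)) ≡ ∑[ v < n ] (𝟙 (adj u v) * D u v)
  ∑-distinguishing-neighbours u = begin
    ∑[ x < n ] card (λ v → adj u v ∧ not (δ x u ≡ᵇ δ x v))
      ≡⟨ sum-cong-≗ (λ x → trans (card≡sum (λ v → adj u v ∧ not (δ x u ≡ᵇ δ x v))) (sum-cong-≗ (λ v → 𝟙-∧ (adj u v) _))) ⟩
    ∑[ x < n ] ∑[ v < n ] (𝟙 (adj u v) * 𝟙 (not (δ x u ≡ᵇ δ x v)))
      ≡⟨ ∑-comm {n} {n} (λ x v → 𝟙 (adj u v) * 𝟙 (not (δ x u ≡ᵇ δ x v))) ⟩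
    ∑[ v < n ] ∑[ x < n ] (𝟙 (adj u v) * 𝟙 (not (δ x u ≡ᵇ δ x v)))
      ≡⟨ sum-cong-≗ (λ v → *-distribˡ-sum {n} (𝟙 (adj u v)) (λ x → 𝟙 (not (δ x u ≡ᵇ δ x v)))) ⟨
    ∑[ v < n ] (𝟙 (adj u v) * ∑[ x < n ] 𝟙 (not (δ x u ≡ᵇ δ x v)))
      ≡⟨ sum-cong-≗ (λ v → cong (𝟙 (adj u v) *_) (card≡sum (λ x → not (δ x u ≡ᵇ δ x v)))) ⟨
    ∑[ v < n ] (𝟙 (adj u v) * D u v) ∎
    where open ≡-Reasoning

  -- Double count the pairs (x, v) with v ~ u and x distinguishing u from v.
  edge-lower-bound : ∀ {M} → (∀ l → l ≤ d → M ≤ b l ⊎ M ≤ c l) →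
                     ∀ {u y} → δ u y ≡ 1 → n * M ≤ k * D u y
  edge-lower-bound {M} M≤b⊎c {u} {y} δ≡1 = begin
    n * M                                                   ≡⟨ sum-const {n} M ⟨
    ∑[ x < n ] M                                            ≤⟨ sum-mono-≤ (distinguishing-neighbours M≤b⊎c u) ⟩
    ∑[ x < n ] card (λ v → adj u v ∧ not (δ x u ≡ᵇ δ x v))  ≡⟨ ∑-distinguishing-neighbours u ⟩
    ∑[ v < n ] (𝟙 (adj u v) * D u v)                        ≡⟨ sum-cong-≗ (λ v → 𝟙-*-cong {adj u v} (λ uv → D-determined (trans (adj⇒dist≡1 uv) (sym δ≡1)))) ⟩
    ∑[ v < n ] (𝟙 (adj u v) * D u y)                        ≡⟨ *-distribʳ-sum (D u y) (λ v → 𝟙 (adj u v)) ⟨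
    (∑[ v < n ] 𝟙 (adj u v)) * D u y                        ≡⟨ cong (_* D u y) (trans (sym (degree u)) (card≡sum (adj u))) ⟨
    k * D u y                                               ∎
    where open ≤-Reasoning

  geodesic-step : ∀ {l} → suc l ≤ d → ∃ λ x → ∃ λ x′ → ∃ λ y → T (adj x x′) × δ x y ≡ suc l × δ x′ y ≡ l
  geodesic-step 1+l≤d with pair-at-distance 1+l≤d
  ... | x , y , δxy with dist-geodesic y x (trans (dist-sym y x) δxy)
  ... | x′ , xx′ , δyx′ = x , x′ , y , xx′ , δxy , trans (dist-sym x′ y) δyx′

  b-shift : ∀ {x x′ y} → T (adj x x′) → δ x y ≡ suc (δ x′ y) → b (δ x y) ≤ b (δ x′ y)
  b-shift {x} {x′} {y} xx′ δ≡ = begin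
    b (δ x y)                                        ≡⟨ neighbours-farther x y ⟨
    card (λ w → adj y w ∧ (δ x w ≡ᵇ suc (δ x y)))    ≤⟨ card-mono-within (adj y) (λ w → δ x w ≡ᵇ suc (δ x y)) (λ w → δ x′ w ≡ᵇ suc (δ x′ y)) farther ⟩
    card (λ w → adj y w ∧ (δ x′ w ≡ᵇ suc (δ x′ y)))  ≡⟨ neighbours-farther x′ y ⟩
    b (δ x′ y)                                       ∎
    where
    open ≤-Reasoning
    farther : ∀ w → T (adj y w) → T (δ x w ≡ᵇ suc (δ x y)) → T (δ x′ w ≡ᵇ suc (δ x′ y))
    farther w yw far = ≡ᵇ⁺ (≤-antisym (dist-adjacent x′ yw) (≤-pred (begin
      suc (suc (δ x′ y)) ≡⟨ cong suc δ≡ ⟨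
      suc (δ x y)        ≡⟨ ≡ᵇ⁻ {δ x w} far ⟨
      δ x w              ≤⟨ dist-adjacent-source xx′ w ⟩
      suc (δ x′ w)       ∎)))

  c-shift : ∀ {x x′ y} → T (adj x x′) → δ x y ≡ suc (δ x′ y) → c (δ x′ y) ≤ c (δ x y)
  c-shift {x} {x′} {y} xx′ δ≡ = begin
    c (δ x′ y)                                       ≡⟨ neighbours-closer x′ y ⟨
    card (λ w → adj y w ∧ (suc (δ x′ w) ≡ᵇ δ x′ y))  ≤⟨ card-mono-within (adj y) (λ w → suc (δ x′ w) ≡ᵇ δ x′ y) (λ w → suc (δ x w) ≡ᵇ δ x y) closer ⟩
    card (λ w → adj y w ∧ (suc (δ x w) ≡ᵇ δ x y))    ≡⟨ neighbours-closer x y ⟩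
    c (δ x y)                                        ∎
    where
    open ≤-Reasoning
    closer : ∀ w → T (adj y w) → T (suc (δ x′ w) ≡ᵇ δ x′ y) → T (suc (δ x w) ≡ᵇ δ x y)
    closer w yw cl = ≡ᵇ⁺ (≤-antisym (begin
      suc (δ x w)        ≤⟨ s≤s (dist-adjacent-source xx′ w) ⟩
      suc (suc (δ x′ w)) ≡⟨ cong suc (≡ᵇ⁻ {suc (δ x′ w)} cl) ⟩
      suc (δ x′ y)       ≡⟨ δ≡ ⟨
      δ x y              ∎) (dist-adjacent x (subst T (symm y w) yw)))

  b-step : ∀ {l} → suc l ≤ d → b (suc l) ≤ b l
  b-step 1+l≤d = let x , x′ , y , xx′ , δxy , δx′y = geodesic-step 1+l≤d in
    subst₂ (λ p q → b p ≤ b q) δxy δx′y (b-shift xx′ (trans δxy (cong suc (sym δx′y))))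

  c-step : ∀ {l} → suc l ≤ d → c l ≤ c (suc l)
  c-step 1+l≤d = let x , x′ , y , xx′ , δxy , δx′y = geodesic-step 1+l≤d in
    subst₂ (λ p q → c p ≤ c q) δx′y δxy (c-shift xx′ (trans δxy (cong suc (sym δx′y))))

  b-antitone : ∀ {l j} → l ≤′ j → j ≤ d → b j ≤ b l
  b-antitone ≤′-refl       _     = ≤-refl
  b-antitone (≤′-step l≤j) 1+j≤d = ≤-trans (b-step 1+j≤d) (b-antitone l≤j (≤-trans (n≤1+n _) 1+j≤d))

  c-monotone : ∀ {l j} → l ≤′ j → j ≤ d → c l ≤ c j
  c-monotone ≤′-refl       _     = ≤-refl
  c-monotone (≤′-step l≤j) 1+j≤d = ≤-trans (c-monotone l≤j (≤-trans (n≤1+n _) 1+j≤d)) (c-step 1+j≤d)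

  sphere-transfer : ∀ {x z x′ z′ y j} → δ x z ≡ δ x′ z′ → δ z y ≡ j →
                    ∃ λ y′ → δ x′ y′ ≡ δ x y × δ z′ y′ ≡ j
  sphere-transfer {x} {z} {x′} {z′} {y} {j} same-dist δzy
    with card-witness (λ y′ → (δ x′ y′ ≡ᵇ δ x y) ∧ (δ z′ y′ ≡ᵇ j))
           (subst (0 <_) (sphereMeet-determined same-dist (δ x y) j)
             (card-pos (λ y′ → (δ x y′ ≡ᵇ δ x y) ∧ (δ z y′ ≡ᵇ j)) y (∧⁺ (≡ᵇ⁺ {δ x y} refl) (≡ᵇ⁺ δzy))))
  ... | y′ , h = let e₁ , e₂ = ∧⁻ {δ x′ y′ ≡ᵇ δ x y} h in y′ , ≡ᵇ⁻ e₁ , ≡ᵇ⁻ e₂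

  module DistanceGraph (i : ℕ) where
    module Wᵢ = Walks (distGraph G i)
    open Wᵢ using () renaming (Walk to Walkᵢ)

    D-along-walk : ∀ {u v} → δ u v ≡ i → ∀ {t x y} → Walkᵢ t x y → D x y ≤ t * D u v
    D-along-walk δuv {x = x} Wᵢ.[] = subst (_≤ _) (sym (D-self x)) z≤n
    D-along-walk {u} {v} δuv {suc t} {x} {y} (Wᵢ._∷_ {w = z} xz p) = begin
      D x y               ≤⟨ D-triangle x z y ⟩
      D x z + D z y       ≤⟨ +-mono-≤ (≤-reflexive (D-determined (trans (≡ᵇ⁻ {δ x z} xz) (sym δuv)))) (D-along-walk δuv p) ⟩
      D u v + t * D u v   ∎
      where open ≤-Reasoning

    -- The distances from x₀ of the vertices reached by walks of length ≤ t, as a subset of {0, …, d}.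
    reached : Fin n → ℕ → Fin (suc d) → Bool
    reached x₀ t l = any (λ y → (δ x₀ y ≡ᵇ toℕ l) ∧ within (distGraph G i) t x₀ y) (allFin n)

    reached⁺ : ∀ {x₀ t y} l → δ x₀ y ≡ toℕ l → Walkᵢ t x₀ y → T (reached x₀ t l)
    reached⁺ {x₀} {t} {y} l δ≡ p =
      any⁺ _ (lose (∈-allFin y) (∧⁺ (≡ᵇ⁺ {δ x₀ y} δ≡) (Wᵢ.walk⇒within p)))

    reached⁻ : ∀ x₀ t l → T (reached x₀ t l) → ∃ λ y → δ x₀ y ≡ toℕ l × Walkᵢ t x₀ y
    reached⁻ x₀ t l h with satisfied (any⁻ _ (allFin n) h)
    ... | y , h′ = let δ≡ , w = ∧⁻ {δ x₀ y ≡ᵇ toℕ l} h′ in y , ≡ᵇ⁻ δ≡ , Wᵢ.within⇒walk t w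

    -- A walk of length t + 2 ends at a distance realised in t + 1 steps once t + 1 steps add nothing:
    -- its penultimate vertex is matched by one reached in t steps, and sphere-transfer extends that one.
    reached-stable-propagates : ∀ x₀ t → reached x₀ (suc t) ⊆ᵇ reached x₀ t →
                                reached x₀ (suc (suc t)) ⊆ᵇ reached x₀ (suc t)
    reached-stable-propagates x₀ t stable l h with reached⁻ x₀ (suc (suc t)) l h
    ... | y , δ≡ , p with Wᵢ.unsnoc p
    ... | inj₁ p′ = reached⁺ l δ≡ p′
    ... | inj₂ (z , q , zy) with reached⁻ x₀ t _ (stable (fromℕ< (dist<1+d x₀ z)) (reached⁺ _ (sym (toℕ-fromℕ< _)) q))
    ... | z′ , δz′ , q′ with sphere-transfer {x₀} {z} {x₀} {z′} {y} (sym (trans δz′ (toℕ-fromℕ< _))) (≡ᵇ⁻ {δ z y} zy)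
    ... | y′ , δy′ , z′y′ = reached⁺ l (trans δy′ δ≡) (q′ Wᵢ.∷ʳ ≡ᵇ⁺ z′y′)

    distance-reached-within-d : ∀ {x₀ t y} → Walkᵢ t x₀ y → ∃ λ y′ → δ x₀ y′ ≡ δ x₀ y × Walkᵢ d x₀ y′
    distance-reached-within-d {x₀} {t} {y} p with reached⁻ x₀ d l saturated
      where
      l = fromℕ< (dist<1+d x₀ y)
      saturated : T (reached x₀ d l)
      saturated = IncreasingChain.saturated (reached x₀)
        (λ t l h → let y , δ≡ , p = reached⁻ x₀ t l h in reached⁺ l δ≡ (Wᵢ.walk-step p))
        (reached-stable-propagates x₀)
        (card-pos (reached x₀ 0) zero (reached⁺ zero (dist-refl x₀) (Wᵢ.[] {0})))
        t l (reached⁺ l (sym (toℕ-fromℕ< _)) p)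
    ... | y′ , δ≡ , p′ = y′ , trans δ≡ (toℕ-fromℕ< _) , p′

  distinguishers-lower-bound : IsPrimitive G d → 1 ≤ d → ∀ {j} → j ≤ d → ∀ {u v} → u ≢ v →
                               n * (b j ℕ.⊓ c (suc j)) ≤ k * (d * D u v)
  distinguishers-lower-bound distance-graphs-connected 1≤d {j} j≤d {u} {v} u≢v =
    let x₀ , y , δx₀y = pair-at-distance 1≤d
        t , x₀⇝y = distance-graphs-connected (δ u v) (n≢0⇒n>0 (u≢v ∘ dist≡0⇒≡)) (dist≤d u v) x₀ y
        y₁ , δx₀y₁ , p = DistanceGraph.distance-reached-within-d (δ u v)
                           (Walks.within⇒walk (distGraph G (δ u v)) t (Equivalence.from T-≡ x₀⇝y))
    in begin
      n * (b j ℕ.⊓ c (suc j))  ≤⟨ edge-lower-bound b⊓c≤b⊎c (trans δx₀y₁ δx₀y) ⟩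
      k * D x₀ y₁            ≤⟨ *-monoʳ-≤ k (DistanceGraph.D-along-walk (δ u v) refl p) ⟩
      k * (d * D u v)        ∎
    where
    open ≤-Reasoning
    b⊓c≤b⊎c : ∀ l → l ≤ d → b j ℕ.⊓ c (suc j) ≤ b l ⊎ b j ℕ.⊓ c (suc j) ≤ c l
    b⊓c≤b⊎c l l≤d with l ≤? j
    ... | yes l≤j = inj₁ (≤-trans (m⊓n≤m (b j) (c (suc j))) (b-antitone (≤⇒≤′ l≤j) j≤d))
    ... | no  l≰j = inj₂ (≤-trans (m⊓n≤n (b j) (c (suc j))) (c-monotone (≤⇒≤′ (≰⇒> l≰j)) l≤d))

-- Passing to ℚ

ι : ℕ → ℚ
ι a = (+ a) / 1

ι≡mkℚ : ∀ a → ι a ≡ mkℚ (+ a) 0 (coprime-sym (1-coprimeTo a))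
ι≡mkℚ a = ℚ.normalize-coprime (coprime-sym (1-coprimeTo a))

ι-mono-≤ : ∀ {a b} → a ≤ b → ι a ≤ℚ ι b
ι-mono-≤ {a} {b} a≤b rewrite ι≡mkℚ a | ι≡mkℚ b =
  *≤* (subst₂ ℤ._≤_ (sym (ℤ.*-identityʳ (+ a))) (sym (ℤ.*-identityʳ (+ b))) (ℤ.+≤+ a≤b))

ι-* : ∀ a b → ι a *ℚ ι b ≡ ι (a * b)
ι-* a b rewrite ι≡mkℚ a | ι≡mkℚ b = cong (_/ 1) (sym (ℤ.pos-* a b))

ι-nonNeg : ∀ a → NonNegative (ι a)
ι-nonNeg a = subst NonNegative (sym (ι≡mkℚ a)) _

ι-pos : ∀ {a} → 0 < a → Positive (ι a)
ι-pos {suc a} _ = subst Positive (sym (ι≡mkℚ (suc a))) _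

⊓-scaled-≤ : ∀ (α β : ℚ) x y k → α *ℚ ι k ≤ℚ ι x → β *ℚ ι k ≤ℚ ι y → (α ⊓ β) *ℚ ι k ≤ℚ ι (x ℕ.⊓ y)
⊓-scaled-≤ α β x y k αk≤x βk≤y with ⊓-sel x y
... | inj₁ x⊓y≡x = subst (λ z → (α ⊓ β) *ℚ ι k ≤ℚ ι z) (sym x⊓y≡x)
                     (ℚ.≤-trans (ℚ.*-monoʳ-≤-nonNeg (ι k) {{ι-nonNeg k}} (ℚ.p⊓q≤p α β)) αk≤x)
... | inj₂ x⊓y≡y = subst (λ z → (α ⊓ β) *ℚ ι k ≤ℚ ι z) (sym x⊓y≡y)
                     (ℚ.≤-trans (ℚ.*-monoʳ-≤-nonNeg (ι k) {{ι-nonNeg k}} (ℚ.p⊓q≤q α β)) βk≤y)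

scaled-count-bound : ∀ {n d D k M} → 2 ≤ d → n * M ≤ k * (d * D) → 2 * (n ∸ 1) * M ≤ d * d * D * k
scaled-count-bound {n} {d} {D} {k} {M} 2≤d nM≤kdD = begin
  2 * (n ∸ 1) * M      ≤⟨ *-monoˡ-≤ M (*-monoʳ-≤ 2 (m∸n≤m n 1)) ⟩
  2 * n * M            ≡⟨ *-assoc 2 n M ⟩
  2 * (n * M)          ≤⟨ *-monoʳ-≤ 2 nM≤kdD ⟩
  2 * (k * (d * D))    ≤⟨ *-monoˡ-≤ (k * (d * D)) 2≤d ⟩
  d * (k * (d * D))    ≡⟨ solve 3 (λ d k D → d :* (k :* (d :* D)) := d :* d :* D :* k) refl d k D ⟩
  d * d * D * k        ∎
  where
  open ≤-Reasoning
  open +-*-Solver using (solve; _:*_; _:=_)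

rational-bound : ∀ {n d D k M} (γ : ℚ) → 2 ≤ d → 0 < k →
                 n * M ≤ k * (d * D) → γ *ℚ ι k ≤ℚ ι M →
                 ι 2 *ℚ γ *ℚ ι (n ∸ 1) ≤ℚ ι (d * d) *ℚ ι D
rational-bound {n} {d} {D} {k} {M} γ 2≤d 0<k nM≤kdD γk≤M =
  ℚ.*-cancelʳ-≤-pos (ι k) {{ι-pos 0<k}} (begin
    ι 2 *ℚ γ *ℚ ι m *ℚ ι k      ≡⟨ rearrange (ι 2) γ (ι m) (ι k) ⟩
    (ι 2 *ℚ ι m) *ℚ (γ *ℚ ι k)  ≤⟨ ℚ.*-monoˡ-≤-nonNeg (ι 2 *ℚ ι m) {{subst NonNegative (sym (ι-* 2 m)) (ι-nonNeg (2 * m))}} γk≤M ⟩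
    (ι 2 *ℚ ι m) *ℚ ι M         ≡⟨ trans (cong (_*ℚ ι M) (ι-* 2 m)) (ι-* (2 * m) M) ⟩
    ι (2 * m * M)               ≤⟨ ι-mono-≤ (scaled-count-bound {n} {d} {D} {k} {M} 2≤d nM≤kdD) ⟩
    ι (d * d * D * k)           ≡⟨ trans (cong (_*ℚ ι k) (ι-* (d * d) D)) (ι-* (d * d * D) k) ⟨
    ι (d * d) *ℚ ι D *ℚ ι k     ∎)
  where
  open ℚ.≤-Reasoning
  open ℚ-Solver.+-*-Solver using (solve; _:*_; _:=_)
  m = n ∸ 1
  rearrange : ∀ (a g p q : ℚ) → a *ℚ g *ℚ p *ℚ q ≡ (a *ℚ p) *ℚ (g *ℚ q)
  rearrange = solve 4 (λ a g p q → a :* g :* p :* q := (a :* p) :* (g :* q)) refl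

proposition3p45 : (n : ℕ) (X : Graph n) (b c : ℕ → ℕ) (d : ℕ) →
    IsDistanceRegular X b c → HasDiameter X d → IsPrimitive X d → 2 ≤ d →
    (α β : ℚ) → Positive α → Positive β →
    (j : ℕ) → 1 ≤ j → j ≤ d ∸ 1 →
    α *ℚ ((+ b 0) / 1) ≤ℚ (+ b j) / 1 →
    β *ℚ ((+ b 0) / 1) ≤ℚ (+ c (suc j)) / 1 →
    (u v : Fin n) → ¬ (u ≡ v) →
    ((+ 2) / 1) *ℚ (α ⊓ β) *ℚ ((+ (n ∸ 1)) / 1)
      ≤ℚ ((+ (d * d)) / 1) *ℚ ((+ numDistinguishing X u v) / 1)
proposition3p45 n X b c d drg diameter isPrimitive 2≤d α β _ _ j _ j≤d∸1 αk≤bj βk≤cj u v u≢v =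
  rational-bound {n} {d} {D u v} {k} {b j ℕ.⊓ c (suc j)} (α ⊓ β) 2≤d (k-pos 1≤d)
    (distinguishers-lower-bound isPrimitive 1≤d (≤-trans j≤d∸1 (m∸n≤m d 1)) u≢v)
    (⊓-scaled-≤ α β (b j) (c (suc j)) k αk≤bj βk≤cj)
  where
  open DistanceRegular X b c d drg diameter
  1≤d : 1 ≤ d
  1≤d = ≤-trans (s≤s z≤n) 2≤d
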